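{- Let $(t_n)_{n\ge0}$ be the Thue–Morse sequence. Let $L_J$ be the set of binary words $w_{n-1}\cdots w_0$ (leading zeroes allowed) such that there is no index $i\in\{0,\dots,n-2\}$ with $w_{i+1}=1$, $w_i=0$ and $t_i=0$, and let $u_n$ be the number of words of length $n$ in $L_J$. Then for all $n\ge3$: $u_n=2u_{n-1}$ if $t_{n-2}=1$; $u_n=\frac43u_{n-1}$ if $t_{n-2}=t_{n-3}=0$; and $u_n=\frac32u_{n-1}$ if $t_{n-2}=0$ and $t_{n-3}=1$.
   Context: The Thue–Morse sequence is defined by $t_n=$ (number of $1$'s in the binary expansion of $n$) mod $2$; so $t=0110100110010110\cdots$. -}

module Defs where

open import Data.Nat using (ℕ; zero; suc; _+_; _*_; _∸_; _<_)
open import Data.Nat.DivMod using (_/_; _%_)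
open import Data.Bool using (Bool; true; false; _∧_; not)
open import Data.Fin using (Fin; toℕ)
open import Data.Vec using (Vec; []; _∷_; lookup)
open import Data.List using (List; []; _∷_; _++_; map; length; filter)
open import Data.Product using (Σ; ∃; _,_; _×_)
open import Relation.Nullary using (¬_; Dec; yes; no)
open import Relation.Nullary.Decidable using (¬?; _×-dec_)
import Data.Nat as N
import Data.Fin.Properties as FP
open import Data.Bool.Properties using () renaming (_≟_ to _≟b_)
open import Relation.Binary.PropositionalEquality using (_≡_)

-- number of 1's in the binary expansion of n.
-- The fuel argument f is always ≥ the number of binary digits when f = n.
onesAux : ℕ → ℕ → ℕ
onesAux zero    n = 0
onesAux (suc f) n = n % 2 + onesAux f (n / 2)

ones : ℕ → ℕ
ones n = onesAux n n

t : ℕ → ℕ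
t n = ones n % 2

-- A binary word w_{n-1} ⋯ w_0 of length n is a vector w : Vec Bool n,
-- with w_i = lookup w i  (true = 1, false = 0).
-- Forbidden pattern at index i (0 ≤ i ≤ n-2): w_{i+1} = 1, w_i = 0, t_i = 0.
InL_J : {n : ℕ} → Vec Bool n → Set
InL_J {n} w =
  ¬ (Σ (Fin n) λ j → Σ (Fin n) λ i →
       (toℕ j ≡ suc (toℕ i)) × (lookup w j ≡ true) × (lookup w i ≡ false) × (t (toℕ i) ≡ 0))

allWords : (n : ℕ) → List (Vec Bool n)
allWords zero    = [] ∷ []
allWords (suc n) = map (true ∷_) (allWords n) ++ map (false ∷_) (allWords n)

InL_J? : {n : ℕ} → (w : Vec Bool n) → Dec (InL_J w)
InL_J? {n} w = ¬? (FP.any? λ j → FP.any? λ i →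
  (toℕ j N.≟ suc (toℕ i)) ×-dec (lookup w j ≟b true) ×-dec (lookup w i ≟b false) ×-dec (t (toℕ i) N.≟ 0))

u : ℕ → ℕ
u n = length (filter InL_J? (allWords n))

{-# OPTIONS --safe #-}
-- Split the valid words of length n + 1 by their last letter.  Appending a 0 never creates the
-- forbidden factor, and appending a 1 creates it only after a 0 at a position i with tᵢ = 0.
-- With eₙ the number of valid words of length n + 1 ending in 1 this gives uₙ₊₁ = eₙ + uₙ, and
-- eₙ₊₁ = eₙ if tₙ = 0 while eₙ₊₁ = uₙ₊₁ otherwise.  Hence uₙ₊₂ = 2uₙ₊₁ when tₙ = 1 and
-- uₙ₊₂ + uₙ = 2uₙ₊₁ when tₙ = 0.  Since t₂ₖ ≠ t₂ₖ₊₁, t has no factor 000, so a 00 ending at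
-- position n - 2 is preceded by a 1; starting from the ratio 2, the second recurrence then
-- produces the ratios 3/2 and 4/3.
module Submission where

open import Defs
open import Data.Nat using (ℕ; zero; suc; _+_; _*_; _∸_; _≥_; _≤_; z≤n; s≤s; s≤s⁻¹)
open import Data.Nat.Properties
  using (≤-refl; ≤-trans; 0≢1+n; suc-injective; +-identityʳ; *-identityˡ; *-distribˡ-+; +-cancelʳ-≡;
         +-commutativeSemigroup)
open import Data.Nat.DivMod
  using (_/_; _%_; result; _divMod_; m/n<m; m%n<n; m*n/n≡m; m*n%n≡0; [m+kn]%n≡m%n; +-distrib-/-∣ʳ;
         %-distribˡ-+)
open import Data.Nat.Divisibility using (n∣m*n)
open import Data.Nat.Tactic.RingSolver using (solve-∀)
open import Algebra.Properties.CommutativeSemigroup +-commutativeSemigroup using (interchange; xy∙z≈y∙xz)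
open import Data.Bool using (Bool; true; false; _∧_; T)
open import Data.Bool.Properties using (∧-assoc; ∧-identityʳ; ∧-zeroʳ; ¬-not; T?; T-≡)
open import Data.Fin using (Fin; toℕ; zero; suc)
open import Data.Vec using (Vec; []; _∷_; _∷ʳ_; lookup)
open import Data.List using (List; []; _∷_; _++_; map; length; filter)
open import Data.List.Properties using (length-++; filter-++; filter-≐; filter-none)
open import Data.List.Relation.Unary.All using (universal)
open import Data.Product using (Σ; _×_; _,_)
open import Function using (_∘_; id)
open import Function.Bundles using (Equivalence)
open import Level using (Level)
open import Relation.Nullary using (¬_; does; contradiction)
open import Relation.Unary using (Pred; Decidable; _≐_)
open import Relation.Binary.PropositionalEquality
  using (_≡_; _≢_; refl; sym; trans; cong; cong₂; subst; module ≡-Reasoning)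
open ≡-Reasoning

private
  variable
    ℓ ℓ′ : Level
    A B : Set ℓ′
    n : ℕ

length-filter-map : {P : Pred B ℓ} (P? : Decidable P) (f : A → B) (xs : List A) →
                    length (filter P? (map f xs)) ≡ length (filter (P? ∘ f) xs)
length-filter-map P? f []       = refl
length-filter-map P? f (x ∷ xs) with does (P? (f x))
... | true  = cong suc (length-filter-map P? f xs)
... | false = length-filter-map P? f xs

count : {P : Pred (Vec Bool n) ℓ} → Decidable P → ℕ
count {n = n} P? = length (filter P? (allWords n))

countᵇ : (Vec Bool n → Bool) → ℕ
countᵇ p = count (T? ∘ p)

count-≐ : {P Q : Pred (Vec Bool n) ℓ} (P? : Decidable P) (Q? : Decidable Q) → P ≐ Q → count P? ≡ count Q?
count-≐ {n = n} P? Q? P≐Q = cong length (filter-≐ P? Q? P≐Q (allWords n))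

countᵇ-cong : {p q : Vec Bool n → Bool} → (∀ w → p w ≡ q w) → countᵇ p ≡ countᵇ q
countᵇ-cong {p = p} {q} p≡q =
  count-≐ (T? ∘ p) (T? ∘ q) ((λ {w} → subst T (p≡q w)) , (λ {w} → subst T (sym (p≡q w))))

countᵇ-false : countᵇ {n} (λ _ → false) ≡ 0
countᵇ-false {n} = cong length (filter-none (T? ∘ λ _ → false) (universal (λ _ → id) (allWords n)))

count-∷ : {P : Pred (Vec Bool (suc n)) ℓ} (P? : Decidable P) →
          count P? ≡ count (λ w → P? (true ∷ w)) + count (λ w → P? (false ∷ w))
count-∷ {n = n} P? = begin
  length (filter P? (map (true ∷_) W ++ map (false ∷_) W))
    ≡⟨ cong length (filter-++ P? (map (true ∷_) W) (map (false ∷_) W)) ⟩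
  length (filter P? (map (true ∷_) W) ++ filter P? (map (false ∷_) W))
    ≡⟨ length-++ (filter P? (map (true ∷_) W)) ⟩
  length (filter P? (map (true ∷_) W)) + length (filter P? (map (false ∷_) W))
    ≡⟨ cong₂ _+_ (length-filter-map P? (true ∷_) W) (length-filter-map P? (false ∷_) W) ⟩
  count (λ w → P? (true ∷ w)) + count (λ w → P? (false ∷ w)) ∎
  where W = allWords n

count-∷ʳ : {P : Pred (Vec Bool (suc n)) ℓ} (P? : Decidable P) →
           count P? ≡ count (λ v → P? (v ∷ʳ true)) + count (λ v → P? (v ∷ʳ false))
count-∷ʳ {n = zero}  P? = trans (count-∷ P?) (cong₂ _+_ (at[] true) (at[] false))
  where
  -- The two deciders agree on the only word [], but not as functions.
  at[] : ∀ b → count (λ w → P? (b ∷ w)) ≡ count (λ v → P? (v ∷ʳ b))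
  at[] b = count-≐ (λ w → P? (b ∷ w)) (λ v → P? (v ∷ʳ b)) ((λ { {[]} → id }) , (λ { {[]} → id }))
count-∷ʳ {n = suc n} P? = begin
  count P?                      ≡⟨ count-∷ P? ⟩
  count P?₁ + count P?₀         ≡⟨ cong₂ _+_ (count-∷ʳ P?₁) (count-∷ʳ P?₀) ⟩
  (c₁₁ + c₁₀) + (c₀₁ + c₀₀)     ≡⟨ interchange c₁₁ c₁₀ c₀₁ c₀₀ ⟩
  (c₁₁ + c₀₁) + (c₁₀ + c₀₀)     ≡⟨ cong₂ _+_ (count-∷ (λ w → P? (w ∷ʳ true))) (count-∷ (λ w → P? (w ∷ʳ false))) ⟨
  count (λ w → P? (w ∷ʳ true)) + count (λ w → P? (w ∷ʳ false)) ∎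
  where
  P?₁ = λ w → P? (true ∷ w)
  P?₀ = λ w → P? (false ∷ w)
  c₁₁ = count (λ v → P?₁ (v ∷ʳ true))
  c₁₀ = count (λ v → P?₁ (v ∷ʳ false))
  c₀₁ = count (λ v → P?₀ (v ∷ʳ true))
  c₀₀ = count (λ v → P?₀ (v ∷ʳ false))

-- allowed (s i) wᵢ wᵢ₊₁; the clauses are ordered so that allowed k true y and
-- allowed (suc k) false true compute for a variable k.
allowed : ℕ → Bool → Bool → Bool
allowed k       true  y     = true
allowed k       false false = true
allowed zero    false true  = false
allowed (suc k) false true  = true

allowed≡false : ∀ k x y → allowed k x y ≡ false → (x ≡ false) × (y ≡ true) × (k ≡ 0)
allowed≡false zero false true refl = refl , refl , refl

valid : (ℕ → ℕ) → Vec Bool n → Bool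
valid s []          = true
valid s (x ∷ [])    = true
valid s (x ∷ y ∷ w) = allowed (s 0) x y ∧ valid (s ∘ suc) (y ∷ w)

Violation : (ℕ → ℕ) → Vec Bool n → Set
Violation {n} s w = Σ (Fin n) λ j → Σ (Fin n) λ i →
  (toℕ j ≡ suc (toℕ i)) × (lookup w j ≡ true) × (lookup w i ≡ false) × (s (toℕ i) ≡ 0)

Violation-∷ : ∀ s x (w : Vec Bool n) → Violation (s ∘ suc) w → Violation s (x ∷ w)
Violation-∷ s x w (j , i , j≡1+i , wⱼ , wᵢ , sᵢ) = suc j , suc i , cong suc j≡1+i , wⱼ , wᵢ , sᵢ

Violation⇒invalid : ∀ s (w : Vec Bool n) → Violation s w → valid s w ≡ false
Violation⇒invalid s (x ∷ [])    (zero , zero , () , _)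
Violation⇒invalid s (x ∷ y ∷ w) (zero , _ , () , _)
Violation⇒invalid s (x ∷ y ∷ w) (suc (suc j) , zero , () , _)
Violation⇒invalid s (false ∷ true ∷ w) (suc zero , zero , refl , refl , refl , s₀≡0) rewrite s₀≡0 = refl
Violation⇒invalid s (x ∷ y ∷ w) (suc j , suc i , j≡1+i , wⱼ , wᵢ , sᵢ) = begin
  allowed (s 0) x y ∧ valid (s ∘ suc) (y ∷ w)
    ≡⟨ cong (allowed (s 0) x y ∧_) (Violation⇒invalid (s ∘ suc) (y ∷ w) (j , i , suc-injective j≡1+i , wⱼ , wᵢ , sᵢ)) ⟩
  allowed (s 0) x y ∧ false
    ≡⟨ ∧-zeroʳ _ ⟩
  false ∎

-- The recursive call is made before the case split, where the termination checker sees
-- it on a subterm of the argument.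
invalid⇒Violation : ∀ s (w : Vec Bool n) → valid s w ≡ false → Violation s w
invalid⇒Violation s (x ∷ y ∷ w) invalid
  with allowed (s 0) x y in ok | invalid⇒Violation (s ∘ suc) (y ∷ w)
... | true  | tail = Violation-∷ s x (y ∷ w) (tail invalid)
... | false | _ with allowed≡false (s 0) x y ok
...   | refl , refl , s₀≡0 = suc zero , zero , refl , refl , refl , s₀≡0

no-Violation≐valid : ∀ s → (λ (w : Vec Bool n) → ¬ Violation s w) ≐ (T ∘ valid s)
no-Violation≐valid s = (λ {w} ok → Equivalence.from T-≡ (¬-not (ok ∘ invalid⇒Violation s w)))
                     , (λ {w} ok v → subst T (Violation⇒invalid s w v) ok)

valid-∷ʳ-false : ∀ s (w : Vec Bool n) → valid s (w ∷ʳ false) ≡ valid s w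
valid-∷ʳ-false s []           = refl
valid-∷ʳ-false s (true  ∷ []) = refl
valid-∷ʳ-false s (false ∷ []) = refl
valid-∷ʳ-false s (x ∷ y ∷ w)  = cong (allowed (s 0) x y ∧_) (valid-∷ʳ-false (s ∘ suc) (y ∷ w))

valid-∷ʳ : ∀ s (v : Vec Bool n) c b → valid s (v ∷ʳ c ∷ʳ b) ≡ valid s (v ∷ʳ c) ∧ allowed (s n) c b
valid-∷ʳ s []          c b = ∧-identityʳ _
valid-∷ʳ s (x ∷ [])    c b = begin
  allowed (s 0) x c ∧ (allowed (s 1) c b ∧ true) ≡⟨ cong (allowed (s 0) x c ∧_) (∧-identityʳ _) ⟩
  allowed (s 0) x c ∧ allowed (s 1) c b          ≡⟨ cong (_∧ allowed (s 1) c b) (∧-identityʳ _) ⟨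
  (allowed (s 0) x c ∧ true) ∧ allowed (s 1) c b ∎
valid-∷ʳ s (x ∷ y ∷ v) c b = trans (cong (allowed (s 0) x y ∧_) (valid-∷ʳ (s ∘ suc) (y ∷ v) c b))
                                   (sym (∧-assoc (allowed (s 0) x y) _ _))

validCount : (ℕ → ℕ) → ℕ → ℕ
validCount s n = countᵇ (valid {n} s)

validEndingTrue : (ℕ → ℕ) → ℕ → ℕ
validEndingTrue s n = countᵇ λ (v : Vec Bool n) → valid s (v ∷ʳ true)

u≡validCount : ∀ n → u n ≡ validCount t n
u≡validCount n = count-≐ (InL_J? {n}) (T? ∘ valid t) (no-Violation≐valid t)

validCount-suc : ∀ s n → validCount s (suc n) ≡ validEndingTrue s n + validCount s n
validCount-suc s n =
  trans (count-∷ʳ (T? ∘ valid {suc n} s)) (cong (validEndingTrue s n +_) (countᵇ-cong {n} (valid-∷ʳ-false s)))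

validEndingTrue-suc : ∀ s n → validEndingTrue s (suc n) ≡
  validEndingTrue s n + countᵇ (λ (v : Vec Bool n) → valid s v ∧ allowed (s n) false true)
validEndingTrue-suc s n = trans (count-∷ʳ (λ (w : Vec Bool (suc n)) → T? (valid s (w ∷ʳ true))))
  (cong₂ _+_ (countᵇ-cong {n} λ v → trans (valid-∷ʳ s v true true) (∧-identityʳ _))
             (countᵇ-cong {n} λ v → trans (valid-∷ʳ s v false true) (cong (_∧ _) (valid-∷ʳ-false s v))))

validEndingTrue-suc-zero : ∀ s n → s n ≡ 0 → validEndingTrue s (suc n) ≡ validEndingTrue s n
validEndingTrue-suc-zero s n sₙ≡0 =
  trans (validEndingTrue-suc s n) (trans (cong (validEndingTrue s n +_) none) (+-identityʳ _))
  where
  none : countᵇ (λ (v : Vec Bool n) → valid s v ∧ allowed (s n) false true) ≡ 0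
  none rewrite sₙ≡0 = trans (countᵇ-cong {n} (λ v → ∧-zeroʳ (valid s v))) (countᵇ-false {n})

validEndingTrue-suc-suc : ∀ s n {k} → s n ≡ suc k → validEndingTrue s (suc n) ≡ validCount s (suc n)
validEndingTrue-suc-suc s n sₙ≡1+k =
  trans (validEndingTrue-suc s n) (trans (cong (validEndingTrue s n +_) all) (sym (validCount-suc s n)))
  where
  all : countᵇ (λ (v : Vec Bool n) → valid s v ∧ allowed (s n) false true) ≡ validCount s n
  all rewrite sₙ≡1+k = countᵇ-cong {n} (λ v → ∧-identityʳ (valid s v))

validCount-rec-suc : ∀ s n {k} → s n ≡ suc k → validCount s (2 + n) ≡ 2 * validCount s (1 + n)
validCount-rec-suc s n sₙ≡1+k = begin
  validCount s (2 + n)                             ≡⟨ validCount-suc s (1 + n) ⟩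
  validEndingTrue s (1 + n) + validCount s (1 + n) ≡⟨ cong (_+ validCount s (1 + n)) (validEndingTrue-suc-suc s n sₙ≡1+k) ⟩
  validCount s (1 + n) + validCount s (1 + n)      ≡⟨ cong (validCount s (1 + n) +_) (+-identityʳ _) ⟨
  2 * validCount s (1 + n)                         ∎

validCount-rec-zero : ∀ s n → s n ≡ 0 → validCount s (2 + n) + validCount s n ≡ 2 * validCount s (1 + n)
validCount-rec-zero s n sₙ≡0 = begin
  validCount s (2 + n) + validCount s n
    ≡⟨ cong (_+ validCount s n) (validCount-suc s (1 + n)) ⟩
  (validEndingTrue s (1 + n) + validCount s (1 + n)) + validCount s n
    ≡⟨ cong (λ e → (e + validCount s (1 + n)) + validCount s n) (validEndingTrue-suc-zero s n sₙ≡0) ⟩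
  (validEndingTrue s n + validCount s (1 + n)) + validCount s n
    ≡⟨ xy∙z≈y∙xz (validEndingTrue s n) (validCount s (1 + n)) (validCount s n) ⟩
  validCount s (1 + n) + (validEndingTrue s n + validCount s n)
    ≡⟨ cong (validCount s (1 + n) +_) (validCount-suc s n) ⟨
  validCount s (1 + n) + validCount s (1 + n)
    ≡⟨ cong (validCount s (1 + n) +_) (+-identityʳ _) ⟨
  2 * validCount s (1 + n) ∎

onesAux-zero : ∀ f → onesAux f 0 ≡ 0
onesAux-zero zero    = refl
onesAux-zero (suc f) = onesAux-zero f

[1+m]/2≤m : ∀ m → suc m / 2 ≤ m
[1+m]/2≤m m = s≤s⁻¹ (m/n<m (suc m) 2 (s≤s (s≤s z≤n)))

onesAux-fuel : ∀ {f g m} → m ≤ f → m ≤ g → onesAux f m ≡ onesAux g m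
onesAux-fuel {zero}  {g}     z≤n _   = sym (onesAux-zero g)
onesAux-fuel {suc f} {zero}  z≤n z≤n = onesAux-zero (suc f)
onesAux-fuel {suc f} {suc g} {zero}  _ _ = trans (onesAux-zero f) (sym (onesAux-zero g))
onesAux-fuel {suc f} {suc g} {suc m} (s≤s m≤f) (s≤s m≤g) =
  cong (suc m % 2 +_) (onesAux-fuel (≤-trans ([1+m]/2≤m m) m≤f) (≤-trans ([1+m]/2≤m m) m≤g))

ones[m]≡m%2+ones[m/2] : ∀ m → ones m ≡ m % 2 + ones (m / 2)
ones[m]≡m%2+ones[m/2] zero    = refl
ones[m]≡m%2+ones[m/2] (suc m) = cong (suc m % 2 +_) (onesAux-fuel ([1+m]/2≤m m) ≤-refl)

ones[k*2]≡ones[k] : ∀ k → ones (k * 2) ≡ ones k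
ones[k*2]≡ones[k] k =
  trans (ones[m]≡m%2+ones[m/2] (k * 2)) (cong₂ _+_ (m*n%n≡0 k 2) (cong ones (m*n/n≡m k 2)))

ones[1+k*2]≡1+ones[k] : ∀ k → ones (suc (k * 2)) ≡ suc (ones k)
ones[1+k*2]≡1+ones[k] k =
  trans (ones[m]≡m%2+ones[m/2] (suc (k * 2))) (cong₂ _+_ ([m+kn]%n≡m%n 1 k 2) (cong ones half))
  where
  half : suc (k * 2) / 2 ≡ k
  half = trans (+-distrib-/-∣ʳ 1 {d = 2} (n∣m*n k)) (m*n/n≡m k 2)

t[1+k*2]≡[1+t[k*2]]%2 : ∀ k → t (suc (k * 2)) ≡ (1 + t (k * 2)) % 2
t[1+k*2]≡[1+t[k*2]]%2 k = begin
  ones (suc (k * 2)) % 2 ≡⟨ cong (_% 2) (ones[1+k*2]≡1+ones[k] k) ⟩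
  (1 + ones k) % 2       ≡⟨ %-distribˡ-+ 1 (ones k) 2 ⟩
  (1 + ones k % 2) % 2   ≡⟨ cong (λ m → (1 + m % 2) % 2) (ones[k*2]≡ones[k] k) ⟨
  (1 + t (k * 2)) % 2    ∎

t[k*2]≡0⇒t[1+k*2]≢0 : ∀ k → t (k * 2) ≡ 0 → t (suc (k * 2)) ≢ 0
t[k*2]≡0⇒t[1+k*2]≢0 k t[k*2]≡0 t[1+k*2]≡0 =
  0≢1+n (trans (sym t[1+k*2]≡0) (trans (t[1+k*2]≡[1+t[k*2]]%2 k) (cong (λ m → (1 + m) % 2) t[k*2]≡0)))

t-no-000 : ∀ j → t j ≡ 0 → t (1 + j) ≡ 0 → t (2 + j) ≢ 0
t-no-000 j tⱼ≡0 tⱼ₊₁≡0 tⱼ₊₂≡0 with j divMod 2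
... | result k zero       refl = t[k*2]≡0⇒t[1+k*2]≢0 k tⱼ≡0 tⱼ₊₁≡0
... | result k (suc zero) refl = t[k*2]≡0⇒t[1+k*2]≢0 (suc k) tⱼ₊₁≡0 tⱼ₊₂≡0

t≢0⇒t≡1 : ∀ j → t j ≢ 0 → t j ≡ 1
t≢0⇒t≡1 j tⱼ≢0 with t j | m%n<n (ones j) 2
... | zero        | _            = contradiction refl tⱼ≢0
... | suc zero    | _            = refl
... | suc (suc _) | s≤s (s≤s ())

ratio-step : ∀ m (x : ℕ → ℕ) i → x (2 + i) + x i ≡ 2 * x (1 + i) → m * x (1 + i) ≡ suc m * x i →
             suc m * x (2 + i) ≡ suc (suc m) * x (1 + i)
ratio-step m x i rec ratio = +-cancelʳ-≡ (m * b) (suc m * a) (suc (suc m) * b) (begin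
  suc m * a + m * b       ≡⟨ cong (suc m * a +_) ratio ⟩
  suc m * a + suc m * c   ≡⟨ *-distribˡ-+ (suc m) a c ⟨
  suc m * (a + c)         ≡⟨ cong (suc m *_) rec ⟩
  suc m * (2 * b)         ≡⟨ expand m b ⟩
  suc (suc m) * b + m * b ∎)
  where
  a = x (2 + i)
  b = x (1 + i)
  c = x i
  expand : ∀ m b → suc m * (2 * b) ≡ suc (suc m) * b + m * b
  expand = solve-∀

u-rec-one : ∀ n → t n ≡ 1 → u (2 + n) ≡ 2 * u (1 + n)
u-rec-one n tₙ≡1 rewrite u≡validCount (2 + n) | u≡validCount (1 + n) = validCount-rec-suc t n tₙ≡1

u-rec-zero : ∀ n → t n ≡ 0 → u (2 + n) + u n ≡ 2 * u (1 + n)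
u-rec-zero n tₙ≡0 rewrite u≡validCount (2 + n) | u≡validCount (1 + n) | u≡validCount n =
  validCount-rec-zero t n tₙ≡0

u-ratio-3/2 : ∀ k → t (1 + k) ≡ 0 → t k ≡ 1 → 2 * u (3 + k) ≡ 3 * u (2 + k)
u-ratio-3/2 k tₖ₊₁≡0 tₖ≡1 =
  ratio-step 1 u (1 + k) (u-rec-zero (1 + k) tₖ₊₁≡0) (trans (*-identityˡ (u (2 + k))) (u-rec-one k tₖ≡1))

u-ratio-4/3 : ∀ k → t (1 + k) ≡ 0 → t k ≡ 0 → 3 * u (3 + k) ≡ 4 * u (2 + k)
u-ratio-4/3 zero    ()
u-ratio-4/3 (suc j) tⱼ₊₂≡0 tⱼ₊₁≡0 = ratio-step 2 u (2 + j) (u-rec-zero (2 + j) tⱼ₊₂≡0) (u-ratio-3/2 j tⱼ₊₁≡0 tⱼ≡1)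
  where
  tⱼ≡1 : t j ≡ 1
  tⱼ≡1 = t≢0⇒t≡1 j (λ tⱼ≡0 → t-no-000 j tⱼ≡0 tⱼ₊₁≡0 tⱼ₊₂≡0)

lemma4 : (n : ℕ) → n ≥ 3 →
    ((t (n ∸ 2) ≡ 1 → u n ≡ 2 * u (n ∸ 1))
     × (t (n ∸ 2) ≡ 0 → t (n ∸ 3) ≡ 0 → 3 * u n ≡ 4 * u (n ∸ 1))
     × (t (n ∸ 2) ≡ 0 → t (n ∸ 3) ≡ 1 → 2 * u n ≡ 3 * u (n ∸ 1)))
lemma4 (suc (suc (suc k))) (s≤s (s≤s (s≤s _))) = u-rec-one (1 + k) , u-ratio-4/3 k , u-ratio-3/2 k
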